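{- Let $n>1$ be an integer, let $S=\{d\in\mathbb N: d=\gcd(\gcd(a,b),n)$ for some $a,b\in\mathbb Z_n$ incomparable with respect to $\leq\}$ and $S'=\{d\in\mathbb N: d=\gcd(\gcd(a-1,b-1),n)$ for some $a,b\in\mathbb Z_n$ incomparable with respect to $\leq\}$. Then every ideal in $\{(n/d): d\in S'\}$ has a largest element if and only if every coset in $\{(n/d)+1: d\in S\}$ has a smallest element (both with respect to $\leq$).
   Context: On $\mathbb Z_n$ define the partial order $\leq$ by: $a\leq b$ iff $a=b$ or $a\equiv ab\pmod n$. For $x\in\mathbb Z_n$, $(x)$ denotes the ideal of $\mathbb Z_n$ generated by $x$, and $(x)+1=\{y+1:y\in(x)\}$. -}

module Defs where

open import Data.Nat using (ℕ; _+_; _*_; _∸_; _<_; NonZero)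
open import Data.Nat.DivMod using (_%_)
open import Data.Nat.GCD using (gcd)
open import Data.Product using (Σ; ∃; _×_)
open import Data.Sum using (_⊎_)
open import Relation.Nullary using (¬_)
open import Relation.Binary.PropositionalEquality using (_≡_)

-- Elements of ℤ_n are represented by naturals x with x < n.

module _ (n : ℕ) .{{_ : NonZero n}} where

  _≼_ : ℕ → ℕ → Set
  a ≼ b = a ≡ b ⊎ a % n ≡ (a * b) % n

  Incomparable : ℕ → ℕ → Set
  Incomparable a b = ¬ (a ≼ b) × ¬ (b ≼ a)

  pred-mod : ℕ → ℕ
  pred-mod a = (a + n ∸ 1) % n

  InS : ℕ → Set
  InS d = Σ ℕ λ a → Σ ℕ λ b → a < n × b < n × Incomparable a b × d ≡ gcd (gcd a b) n

  InS' : ℕ → Set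
  InS' d = Σ ℕ λ a → Σ ℕ λ b → a < n × b < n × Incomparable a b
             × d ≡ gcd (gcd (pred-mod a) (pred-mod b)) n

  InIdeal : ℕ → ℕ → Set
  InIdeal g x = x < n × ∃ λ k → x ≡ (g * k) % n

  InCoset : ℕ → ℕ → Set
  InCoset g x = x < n × ∃ λ y → InIdeal g y × x ≡ (y + 1) % n

  HasLargest : (ℕ → Set) → Set
  HasLargest P = ∃ λ x → P x × (∀ y → P y → y ≼ x)

  HasSmallest : (ℕ → Set) → Set
  HasSmallest P = ∃ λ x → P x × (∀ y → P y → x ≼ y)

-- The map a ↦ 1 - a is an involution of ℤ_n that reverses ≤: from a ≡ ab one
-- gets a(1 - b) ≡ 0 and hence (1 - b)(1 - a) ≡ 1 - b. It exchanges the ideal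
-- (g) with the coset (g) + 1, so it turns a largest element of one into a
-- smallest element of the other. It also preserves incomparability and sends
-- a - 1 to -a, and gcd(gcd(a, b), n) is unchanged when a, b are replaced by
-- -a, -b; hence S = S', and both conditions range over the same divisors d.
module Submission where

open import Defs
open import Data.Nat using (ℕ; suc; pred; _+_; _*_; _∸_; _<_; NonZero; >-nonZero⁻¹)
open import Data.Nat.Properties
  using (+-comm; +-assoc; +-identityʳ; *-identityˡ; *-identityʳ; *-comm; *-assoc; *-suc;
         *-distribˡ-+; *-distribʳ-+;
         suc-pred; m∸n+n≡m; ≤-trans; m≤n+m; +-commutativeSemigroup)
open import Data.Nat.DivMod using (_%_; m%n%n≡m%n; m%n<n; [m+n]%n≡m%n; m*n%n≡0;
  %-distribˡ-+; %-distribˡ-*; m<n⇒m%n≡m)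
open import Data.Nat.Divisibility using (_∣_; ∣-trans; ∣-antisym; ∣m+n∣m⇒∣n; m%n≡0⇒n∣m)
open import Data.Nat.GCD using (gcd; gcd[m,n]∣m; gcd[m,n]∣n; gcd-greatest)
open import Data.Product using (_×_; _,_; proj₁)
open import Data.Sum using (inj₁; inj₂)
open import Function.Base using (_on_)
open import Relation.Binary.Bundles using (Setoid)
import Relation.Binary.Construct.On as On
open import Relation.Binary.PropositionalEquality
  using (_≡_; refl; sym; trans; cong; cong₂; subst; subst₂; isEquivalence)
import Relation.Binary.Reasoning.Setoid as SetoidReasoning
open import Algebra.Properties.CommutativeSemigroup +-commutativeSemigroup
  using (xy∙z≈xz∙y; x∙yz≈y∙xz)

gcd[gcd[p,q],n]∣gcd[gcd[a,b],n] : ∀ {n} p q a b → n ∣ p + a → n ∣ q + b →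
                                  gcd (gcd p q) n ∣ gcd (gcd a b) n
gcd[gcd[p,q],n]∣gcd[gcd[a,b],n] {n} p q a b n∣p+a n∣q+b =
  gcd-greatest (gcd-greatest d∣a d∣b) d∣n
  where
  d : ℕ
  d = gcd (gcd p q) n

  d∣n : d ∣ n
  d∣n = gcd[m,n]∣n (gcd p q) n

  d∣a : d ∣ a
  d∣a = ∣m+n∣m⇒∣n (∣-trans d∣n n∣p+a) (∣-trans (gcd[m,n]∣m (gcd p q) n) (gcd[m,n]∣m p q))

  d∣b : d ∣ b
  d∣b = ∣m+n∣m⇒∣n (∣-trans d∣n n∣q+b) (∣-trans (gcd[m,n]∣m (gcd p q) n) (gcd[m,n]∣n p q))

gcd[gcd[p,q],n]≡gcd[gcd[a,b],n] : ∀ {n} p q a b → n ∣ p + a → n ∣ q + b →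
                                  gcd (gcd p q) n ≡ gcd (gcd a b) n
gcd[gcd[p,q],n]≡gcd[gcd[a,b],n] {n} p q a b n∣p+a n∣q+b = ∣-antisym
  (gcd[gcd[p,q],n]∣gcd[gcd[a,b],n] p q a b n∣p+a n∣q+b)
  (gcd[gcd[p,q],n]∣gcd[gcd[a,b],n] a b p q (subst (n ∣_) (+-comm p a) n∣p+a)
                                   (subst (n ∣_) (+-comm q b) n∣q+b))

module _ (n : ℕ) .{{_ : NonZero n}} where

  infix 4 _≈_ _≼ₙ_
  infix 8 -_ 1-_

  _≼ₙ_ : ℕ → ℕ → Set
  _≼ₙ_ = _≼_ n

  _≈_ : ℕ → ℕ → Set
  _≈_ = _≡_ on (_% n)

  ≈-setoid : Setoid _ _
  ≈-setoid = record { isEquivalence = On.isEquivalence (_% n) isEquivalence }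

  open SetoidReasoning ≈-setoid

  %-≈ : ∀ a → a % n ≈ a
  %-≈ a = m%n%n≡m%n a n

  ≡%⇒≈ : ∀ {a b} → a ≡ b % n → a ≈ b
  ≡%⇒≈ {b = b} a≡b%n = trans (cong (_% n) a≡b%n) (%-≈ b)

  ≈⇒≡ : ∀ {a b} → a < n → b < n → a ≈ b → a ≡ b
  ≈⇒≡ a<n b<n a≈b = trans (sym (m<n⇒m%n≡m a<n)) (trans a≈b (m<n⇒m%n≡m b<n))

  +-cong : ∀ {a a′ b b′} → a ≈ a′ → b ≈ b′ → a + b ≈ a′ + b′
  +-cong {a} {a′} {b} {b′} a≈a′ b≈b′ = trans (%-distribˡ-+ a b n)
    (trans (cong₂ (λ u v → (u + v) % n) a≈a′ b≈b′) (sym (%-distribˡ-+ a′ b′ n)))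

  *-cong : ∀ {a a′ b b′} → a ≈ a′ → b ≈ b′ → a * b ≈ a′ * b′
  *-cong {a} {a′} {b} {b′} a≈a′ b≈b′ = trans (%-distribˡ-* a b n)
    (trans (cong₂ (λ u v → (u * v) % n) a≈a′ b≈b′) (sym (%-distribˡ-* a′ b′ n)))

  +-congˡ : ∀ a {b b′} → b ≈ b′ → a + b ≈ a + b′
  +-congˡ a = +-cong {a} refl

  +-congʳ : ∀ b {a a′} → a ≈ a′ → a + b ≈ a′ + b
  +-congʳ b a≈a′ = +-cong a≈a′ (refl {x = b % n})

  *-congˡ : ∀ a {b b′} → b ≈ b′ → a * b ≈ a * b′
  *-congˡ a = *-cong {a} refl

  *-congʳ : ∀ b {a a′} → a ≈ a′ → a * b ≈ a′ * b
  *-congʳ b a≈a′ = *-cong a≈a′ (refl {x = b % n})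

  -- Additive inverse modulo n, avoiding truncated subtraction.
  -_ : ℕ → ℕ
  - x = x * pred n

  +-inverseʳ : ∀ x → x + - x ≈ 0
  +-inverseʳ x = begin
    x + x * pred n   ≡⟨ *-suc x (pred n) ⟨
    x * suc (pred n) ≡⟨ cong (x *_) (suc-pred n) ⟩
    x * n            ≈⟨ trans (m*n%n≡0 x n) (sym (m*n%n≡0 0 n)) ⟩
    0                ∎

  +-cancelʳ : ∀ {a b} c → a + c ≈ b + c → a ≈ b
  +-cancelʳ {a} {b} c a+c≈b+c = begin
    a                ≡⟨ +-identityʳ a ⟨
    a + 0            ≈⟨ +-congˡ a (+-inverseʳ c) ⟨
    a + (c + - c)    ≡⟨ +-assoc a c (- c) ⟨
    a + c + - c      ≈⟨ +-congʳ (- c) a+c≈b+c ⟩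
    b + c + - c      ≡⟨ +-assoc b c (- c) ⟩
    b + (c + - c)    ≈⟨ +-congˡ b (+-inverseʳ c) ⟩
    b + 0            ≡⟨ +-identityʳ b ⟩
    b                ∎

  1-_ : ℕ → ℕ
  1- a = (1 + - a) % n

  1-a<n : ∀ a → 1- a < n
  1-a<n a = m%n<n (1 + - a) n

  1-a+a≈1 : ∀ a → 1- a + a ≈ 1
  1-a+a≈1 a = begin
    1- a + a         ≈⟨ +-congʳ a (%-≈ (1 + - a)) ⟩
    1 + - a + a      ≡⟨ xy∙z≈xz∙y 1 (- a) a ⟩
    1 + a + - a      ≡⟨ +-assoc 1 a (- a) ⟩
    1 + (a + - a)    ≈⟨ +-congˡ 1 (+-inverseʳ a) ⟩
    1 + 0            ∎

  1-1-a≈a : ∀ a → 1- 1- a ≈ a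
  1-1-a≈a a = +-cancelʳ (1- a) (begin
    1- 1- a + 1- a   ≈⟨ 1-a+a≈1 (1- a) ⟩
    1                ≈⟨ 1-a+a≈1 a ⟨
    1- a + a         ≡⟨ +-comm (1- a) a ⟩
    a + 1- a         ∎)

  1-1-a≡a : ∀ {a} → a < n → 1- 1- a ≡ a
  1-1-a≡a {a} a<n = ≈⇒≡ (1-a<n (1- a)) a<n (1-1-a≈a a)

  1-‿antitone : ∀ {a b} → a ≼ₙ b → 1- b ≼ₙ 1- a
  1-‿antitone (inj₁ refl) = inj₁ refl
  1-‿antitone {a} {b} (inj₂ a≈ab) = inj₂ (begin
    1- b                          ≡⟨ *-identityʳ (1- b) ⟨
    1- b * 1                      ≈⟨ *-congˡ (1- b) (1-a+a≈1 a) ⟨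
    1- b * (1- a + a)             ≡⟨ *-distribˡ-+ (1- b) (1- a) a ⟩
    1- b * 1- a + 1- b * a        ≈⟨ +-congˡ (1- b * 1- a) [1-b]a≈0 ⟩
    1- b * 1- a + 0               ≡⟨ +-identityʳ (1- b * 1- a) ⟩
    1- b * 1- a                   ∎)
    where
    [1-b]a≈0 : 1- b * a ≈ 0
    [1-b]a≈0 = +-cancelʳ (b * a) (begin
      1- b * a + b * a   ≡⟨ *-distribʳ-+ a (1- b) b ⟨
      (1- b + b) * a     ≈⟨ *-congʳ a (1-a+a≈1 b) ⟩
      1 * a              ≡⟨ *-identityˡ a ⟩
      a                  ≈⟨ a≈ab ⟩
      a * b              ≡⟨ *-comm a b ⟩
      b * a              ∎)

  1-‿incomparable : ∀ {a b} → a < n → b < n → Incomparable n a b →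
                    Incomparable n (1- a) (1- b)
  1-‿incomparable a<n b<n (a⋠b , b⋠a) =
      (λ 1-a≼1-b → b⋠a (reflect a<n b<n 1-a≼1-b))
    , (λ 1-b≼1-a → a⋠b (reflect b<n a<n 1-b≼1-a))
    where
    reflect : ∀ {a b} → a < n → b < n → 1- a ≼ₙ 1- b → b ≼ₙ a
    reflect a<n b<n 1-a≼1-b =
      subst₂ _≼ₙ_ (1-1-a≡a b<n) (1-1-a≡a a<n) (1-‿antitone 1-a≼1-b)

  pred-mod+1≈a : ∀ a → pred-mod n a + 1 ≈ a
  pred-mod+1≈a a = begin
    pred-mod n a + 1   ≈⟨ +-congʳ 1 (%-≈ (a + n ∸ 1)) ⟩
    a + n ∸ 1 + 1      ≡⟨ m∸n+n≡m (≤-trans (>-nonZero⁻¹ n) (m≤n+m n a)) ⟩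
    a + n              ≈⟨ [m+n]%n≡m%n a n ⟩
    a                  ∎

  pred-mod+1-a≈0 : ∀ a → pred-mod n a + 1- a ≈ 0
  pred-mod+1-a≈0 a = +-cancelʳ 1 (begin
    pred-mod n a + 1- a + 1   ≡⟨ xy∙z≈xz∙y (pred-mod n a) (1- a) 1 ⟩
    pred-mod n a + 1 + 1- a   ≈⟨ +-congʳ (1- a) (pred-mod+1≈a a) ⟩
    a + 1- a                  ≡⟨ +-comm a (1- a) ⟩
    1- a + a                  ≈⟨ 1-a+a≈1 a ⟩
    1                         ∎)

  pred-mod[1-a]+a≈0 : ∀ a → pred-mod n (1- a) + a ≈ 0
  pred-mod[1-a]+a≈0 a = begin
    pred-mod n (1- a) + a        ≈⟨ +-congˡ (pred-mod n (1- a)) (1-1-a≈a a) ⟨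
    pred-mod n (1- a) + 1- 1- a  ≈⟨ pred-mod+1-a≈0 (1- a) ⟩
    0                            ∎

  ≈0⇒∣ : ∀ x → x ≈ 0 → n ∣ x
  ≈0⇒∣ x x≈0 = m%n≡0⇒n∣m x n (trans x≈0 (m*n%n≡0 0 n))

  n∣pred-mod+1-a : ∀ a → n ∣ pred-mod n a + 1- a
  n∣pred-mod+1-a a = ≈0⇒∣ (pred-mod n a + 1- a) (pred-mod+1-a≈0 a)

  n∣pred-mod[1-a]+a : ∀ a → n ∣ pred-mod n (1- a) + a
  n∣pred-mod[1-a]+a a = ≈0⇒∣ (pred-mod n (1- a) + a) (pred-mod[1-a]+a≈0 a)

  InS⇒InS' : ∀ {d} → InS n d → InS' n d
  InS⇒InS' (a , b , a<n , b<n , a∥b , d≡) =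
    1- a , 1- b , 1-a<n a , 1-a<n b , 1-‿incomparable a<n b<n a∥b ,
    trans d≡ (sym (gcd[gcd[p,q],n]≡gcd[gcd[a,b],n] (pred-mod n (1- a)) (pred-mod n (1- b)) a b
                     (n∣pred-mod[1-a]+a a) (n∣pred-mod[1-a]+a b)))

  InS'⇒InS : ∀ {d} → InS' n d → InS n d
  InS'⇒InS (a , b , a<n , b<n , a∥b , d≡) =
    1- a , 1- b , 1-a<n a , 1-a<n b , 1-‿incomparable a<n b<n a∥b ,
    trans d≡ (gcd[gcd[p,q],n]≡gcd[gcd[a,b],n] (pred-mod n a) (pred-mod n b) (1- a) (1- b)
                (n∣pred-mod+1-a a) (n∣pred-mod+1-a b))

  1-‿ideal⇒coset : ∀ {g x} → InIdeal n g x → InCoset n g (1- x)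
  1-‿ideal⇒coset {g} {x} (_ , k , x≡gk) =
    1-a<n x , (g * (k * pred n)) % n , (m%n<n (g * (k * pred n)) n , k * pred n , refl) ,
    (begin
      1 + - x                      ≈⟨ +-congˡ 1 (*-congʳ (pred n) (≡%⇒≈ x≡gk)) ⟩
      1 + - (g * k)                ≡⟨ cong (1 +_) (*-assoc g k (pred n)) ⟩
      1 + g * (k * pred n)         ≡⟨ +-comm 1 (g * (k * pred n)) ⟩
      g * (k * pred n) + 1         ≈⟨ +-congʳ 1 (%-≈ (g * (k * pred n))) ⟨
      (g * (k * pred n)) % n + 1   ∎)

  1-‿coset⇒ideal : ∀ {g y} → InCoset n g y → InIdeal n g (1- y)
  1-‿coset⇒ideal {g} {y} (_ , z , (_ , k , z≡gk) , y≡z+1) =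
    1-a<n y , k * pred n , (begin
      1 + - y                      ≈⟨ +-congˡ 1 (*-congʳ (pred n) y≈gk+1) ⟩
      1 + - (g * k + 1)            ≡⟨ cong (1 +_) (*-distribʳ-+ (pred n) (g * k) 1) ⟩
      1 + (- (g * k) + - 1)        ≡⟨ x∙yz≈y∙xz 1 (- (g * k)) (- 1) ⟩
      - (g * k) + (1 + - 1)        ≈⟨ +-congˡ (- (g * k)) (+-inverseʳ 1) ⟩
      - (g * k) + 0                ≡⟨ +-identityʳ (- (g * k)) ⟩
      g * k * pred n               ≡⟨ *-assoc g k (pred n) ⟩
      g * (k * pred n)             ∎)
    where
    y≈gk+1 : y ≈ g * k + 1
    y≈gk+1 = trans (≡%⇒≈ y≡z+1) (+-congʳ 1 (≡%⇒≈ z≡gk))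

  module _ {P Q : ℕ → Set}
           (P⊆ℤₙ : ∀ {x} → P x → x < n) (Q⊆ℤₙ : ∀ {y} → Q y → y < n)
           (P⇒Q : ∀ {x} → P x → Q (1- x)) (Q⇒P : ∀ {y} → Q y → P (1- y)) where

    largest⇒smallest : HasLargest n P → HasSmallest n Q
    largest⇒smallest (x , Px , x-largest) = 1- x , P⇒Q Px , λ y Qy →
      subst (1- x ≼ₙ_) (1-1-a≡a (Q⊆ℤₙ Qy)) (1-‿antitone (x-largest (1- y) (Q⇒P Qy)))

    smallest⇒largest : HasSmallest n Q → HasLargest n P
    smallest⇒largest (x , Qx , x-smallest) = 1- x , Q⇒P Qx , λ y Py →
      subst (_≼ₙ 1- x) (1-1-a≡a (P⊆ℤₙ Py)) (1-‿antitone (x-smallest (1- y) (P⇒Q Py)))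

  ideal-largest⇒coset-smallest : ∀ g → HasLargest n (InIdeal n g) → HasSmallest n (InCoset n g)
  ideal-largest⇒coset-smallest g =
    largest⇒smallest proj₁ proj₁ (1-‿ideal⇒coset {g}) (1-‿coset⇒ideal {g})

  coset-smallest⇒ideal-largest : ∀ g → HasSmallest n (InCoset n g) → HasLargest n (InIdeal n g)
  coset-smallest⇒ideal-largest g =
    smallest⇒largest proj₁ proj₁ (1-‿ideal⇒coset {g}) (1-‿coset⇒ideal {g})

corollary3p5 : (n : ℕ) .{{_ : NonZero n}} → 1 < n →
    ((∀ d → InS' n d → ∀ g → g * d ≡ n → HasLargest n (InIdeal n g)) →
       (∀ d → InS n d → ∀ g → g * d ≡ n → HasSmallest n (InCoset n g)))
    × ((∀ d → InS n d → ∀ g → g * d ≡ n → HasSmallest n (InCoset n g)) →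
       (∀ d → InS' n d → ∀ g → g * d ≡ n → HasLargest n (InIdeal n g)))
corollary3p5 n _ =
    (λ ideals-have-largest d d∈S g g*d≡n → ideal-largest⇒coset-smallest n g
       (ideals-have-largest d (InS⇒InS' n d∈S) g g*d≡n))
  , (λ cosets-have-smallest d d∈S' g g*d≡n → coset-smallest⇒ideal-largest n g
       (cosets-have-smallest d (InS'⇒InS n d∈S') g g*d≡n))
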